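{- Let $G$ be a connected bipartite graph with bipartition $X\cup Y$ such that $|X|\le |Y|$. If $\gamma(G)=|X|$, then $G$ contains a matching with $|X|$ edges.
   Context: All graphs are finite and simple. $\gamma(G)$ is the domination number of $G$: the minimum size of a set $S\subseteq V(G)$ such that every vertex of $G$ is in $S$ or adjacent to a vertex of $S$. -}

module Defs where

open import Data.Nat using (ℕ; _≤_)
open import Data.Bool using (Bool; true; false)
open import Data.Fin using (Fin)
open import Data.Fin.Subset using (Subset; _∈_; _∉_; ∣_∣; ∁)
open import Data.Product using (Σ; ∃; _×_; _,_)
open import Data.Sum using (_⊎_)
open import Data.List using (List; length; concatMap; _∷_; [])
open import Data.List.Relation.Unary.All using (All)
open import Data.List.Relation.Unary.Unique.Propositional using (Unique)
open import Relation.Binary.PropositionalEquality using (_≡_)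

record Graph (n : ℕ) : Set where
  field
    adj     : Fin n → Fin n → Bool
    symm    : ∀ u v → adj u v ≡ adj v u
    irrefl  : ∀ v → adj v v ≡ false

open Graph public

data Walk {n : ℕ} (G : Graph n) : Fin n → Fin n → Set where
  here : ∀ {v} → Walk G v v
  step : ∀ {u w v} → adj G u w ≡ true → Walk G w v → Walk G u v

Connected : ∀ {n} → Graph n → Set
Connected {n} G = (u v : Fin n) → Walk G u v

-- X ∪ Y (Y = complement of X) is a bipartition of G: every edge joins X and Y.
IsBipartition : ∀ {n} → Graph n → Subset n → Set
IsBipartition {n} G X =
  (u v : Fin n) → adj G u v ≡ true → (u ∈ X × v ∉ X) ⊎ (u ∉ X × v ∈ X)

Dominating : ∀ {n} → Graph n → Subset n → Set
Dominating {n} G S =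
  (v : Fin n) → v ∈ S ⊎ (Σ (Fin n) λ u → u ∈ S × adj G u v ≡ true)

DominationNumber : ∀ {n} → Graph n → ℕ → Set
DominationNumber {n} G k =
  (Σ (Subset n) λ S → Dominating G S × ∣ S ∣ ≡ k)
  × ((S : Subset n) → Dominating G S → k ≤ ∣ S ∣)

-- A matching: a list of edges whose endpoints are pairwise distinct
-- (so the edges are pairwise vertex-disjoint); its size is the list length.
endpoints : ∀ {n} → List (Fin n × Fin n) → List (Fin n)
endpoints = concatMap (λ { (u , v) → u ∷ v ∷ [] })

IsMatching : ∀ {n} → Graph n → List (Fin n × Fin n) → Set
IsMatching G M = All (λ { (u , v) → adj G u v ≡ true }) M × Unique (endpoints M)

module Submission where

open import Defs
open import Level using (0ℓ)
open import Function using (_∘_)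
open import Function.Bundles using (Equivalence)
open import Data.Empty using (⊥; ⊥-elim)
open import Data.Product using (Σ; ∃; _×_; _,_)
open import Data.Sum using (_⊎_; inj₁; inj₂)
open import Data.Bool using (Bool; true)
open import Data.Bool.Properties using (T-≡) renaming (_≟_ to _≟ᵇ_)
open import Data.Nat using (ℕ; zero; suc; _≤_; _<_; z≤n; s≤s)
open import Data.Nat.Properties
  using (module ≤-Reasoning; ≤-reflexive; ≤-trans; ≤-refl; ≤-pred; n≤1+n; <-≤-trans; <⇒≱)
open import Data.Fin using (Fin; zero; suc)
open import Data.Fin.Properties using (any?; _≟_; suc-injective)
open import Data.Fin.Subset using (Subset; _∈_; _∉_; ∣_∣; ∁; _─_; _-_; ⁅_⁆; inside; outside; Empty)
open import Data.Fin.Subset.Properties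
  using ( _∈?_; nonempty?; Empty-unique; ∣⊥∣≡0; p─⊥≡p; p─q⊆p; x∈⁅x⁆
        ; x∈p∧x≢y⇒x∈p-y; x∈p⇒∣p-x∣<∣p∣; x∈∁p⇒x∉p)
open import Data.Vec using (_∷_; []; tabulate)
open import Data.Vec.Base using (here; there)
open import Data.Vec.Properties using (lookup∘tabulate; lookup⇒[]=; []=⇒lookup)
open import Data.Vec.Functional using (updateAt)
open import Data.Vec.Functional.Properties using (updateAt-updates; updateAt-minimal)
open import Data.List using (List; []; _∷_; length; map)
open import Data.List.Properties using (length-map)
open import Data.List.Relation.Unary.All as All using (All; []; _∷_)
import Data.List.Relation.Unary.All.Properties as AllP
open import Data.List.Relation.Unary.AllPairs using ([]; _∷_)
open import Data.List.Relation.Unary.Unique.Propositional using (Unique)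
import Data.List.Relation.Unary.Unique.Propositional.Properties as Unique
open import Relation.Nullary using (Dec; yes; no; ¬_; _×-dec_; _⊎-dec_)
open import Relation.Nullary.Decidable using (isYes; toWitness; fromWitness)
open import Relation.Unary using (Pred; Decidable; _⊆_; ∅; _∪_; ｛_｝)
open import Relation.Unary.Properties using (∅?; _∪?_)
open import Relation.Binary.PropositionalEquality using (_≡_; refl; sym; trans; cong; subst; _≢_)

-- By Hall's theorem either X can be matched injectively into its
-- neighbourhood -- and the edges x f(x) form the required matching -- or
-- there is a set S ⊆ X with fewer neighbours than elements.  In the second
-- case fix x0 ∈ S and an injection of S - x0 onto N(S).  Replacing every
-- vertex of S by its partner (and discarding x0) turns X into a set D of size
-- at most ∣ X ∣ - 1, which still dominates G: N(S) ⊆ D dominates S and every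
-- neighbour of S, and X - S ⊆ D dominates the rest of Y.  Connectivity (with
-- Y ≠ ∅) is only used to know that no vertex is isolated.  This contradicts
-- γ(G) = ∣ X ∣.

x∈q⇒x∉p─q : ∀ {n} (p q : Subset n) {x : Fin n} → x ∈ q → x ∉ p ─ q
x∈q⇒x∉p─q (_ ∷ p) (inside ∷ q) here ()
x∈q⇒x∉p─q (_ ∷ p) (_ ∷ q) (there x∈q) (there x∈p─q) = x∈q⇒x∉p─q p q x∈q x∈p─q

x∈p-y⇒x≢y : ∀ {n} (p : Subset n) {x y : Fin n} → x ∈ p - y → x ≢ y
x∈p-y⇒x≢y p {x} x∈p-x refl = x∈q⇒x∉p─q p ⁅ x ⁆ (x∈⁅x⁆ x) x∈p-x

∣p∣≤1+∣p-x∣ : ∀ {n} (p : Subset n) (x : Fin n) → ∣ p ∣ ≤ suc ∣ p - x ∣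
∣p∣≤1+∣p-x∣ (inside ∷ p)  zero    = s≤s (≤-reflexive (sym (cong ∣_∣ (p─⊥≡p p))))
∣p∣≤1+∣p-x∣ (outside ∷ p) zero    = ≤-trans (≤-reflexive (sym (cong ∣_∣ (p─⊥≡p p)))) (n≤1+n _)
∣p∣≤1+∣p-x∣ (inside ∷ p)  (suc x) = s≤s (∣p∣≤1+∣p-x∣ p x)
∣p∣≤1+∣p-x∣ (outside ∷ p) (suc x) = ∣p∣≤1+∣p-x∣ p x

∣Empty∣≡0 : ∀ {n} {p : Subset n} → Empty p → ∣ p ∣ ≡ 0
∣Empty∣≡0 {n} p-empty = trans (cong ∣_∣ (Empty-unique p-empty)) (∣⊥∣≡0 n)

InImage : ∀ {m n} → (Fin m → Fin n) → Subset m → Fin n → Set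
InImage g A b = ∃ λ a → a ∈ A × g a ≡ b

-- Pigeonhole for subsets: if every element of B is the g-image of an element
-- of A, then B has at most as many elements as A.  (Induction on a bound for
-- ∣ A ∣, removing one b ∈ B together with one preimage a ∈ A.)
∣B∣≤∣A∣-of-cover : ∀ {m n} (g : Fin m → Fin n) (A : Subset m) (B : Subset n) →
  (∀ {b} → b ∈ B → InImage g A b) → ∣ B ∣ ≤ ∣ A ∣
∣B∣≤∣A∣-of-cover g A B = bounded ∣ A ∣ A B ≤-refl
  where
  bounded : ∀ k A B → ∣ A ∣ ≤ k → (∀ {b} → b ∈ B → InImage g A b) → ∣ B ∣ ≤ ∣ A ∣
  bounded k A B ∣A∣≤k cover with nonempty? B
  ... | no B-empty = subst (_≤ ∣ A ∣) (sym (∣Empty∣≡0 B-empty)) z≤n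
  bounded zero A B ∣A∣≤0 cover | yes (b , b∈B) with cover b∈B
  ... | a , a∈A , _ with ≤-trans (x∈p⇒∣p-x∣<∣p∣ a∈A) ∣A∣≤0
  ...   | ()
  bounded (suc k) A B ∣A∣≤1+k cover | yes (b , b∈B) with cover b∈B
  ... | a , a∈A , ga≡b = begin
      ∣ B ∣              ≤⟨ ∣p∣≤1+∣p-x∣ B b ⟩
      suc ∣ B - b ∣      ≤⟨ s≤s (bounded k (A - a) (B - b) ∣A-a∣≤k cover-b) ⟩
      suc ∣ A - a ∣      ≤⟨ x∈p⇒∣p-x∣<∣p∣ a∈A ⟩
      ∣ A ∣              ∎
    where
    open ≤-Reasoning
    ∣A-a∣≤k : ∣ A - a ∣ ≤ k
    ∣A-a∣≤k = ≤-pred (≤-trans (x∈p⇒∣p-x∣<∣p∣ a∈A) ∣A∣≤1+k)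
    -- a preimage of b′ ≢ b cannot be a, since g a ≡ b
    cover-b : ∀ {b′} → b′ ∈ B - b → InImage g (A - a) b′
    cover-b b′∈B-b with cover (p─q⊆p B ⁅ b ⁆ b′∈B-b)
    ... | a′ , a′∈A , ga′≡b′ =
      a′ , x∈p∧x≢y⇒x∈p-y a′∈A (λ { refl → x∈p-y⇒x≢y B b′∈B-b (trans (sym ga′≡b′) ga≡b) }) , ga′≡b′

inImage? : ∀ {m n} (g : Fin m → Fin n) (A : Subset m) b → Dec (InImage g A b)
inImage? g A b = any? (λ a → (a ∈? A) ×-dec (g a ≟ b))

image : ∀ {m n} → (Fin m → Fin n) → Subset m → Subset n
image g A = tabulate (λ b → isYes (inImage? g A b))

∈-image⁺ : ∀ {m n} (g : Fin m → Fin n) {A : Subset m} {a : Fin m} → a ∈ A → g a ∈ image g A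
∈-image⁺ g {A} {a} a∈A =
  lookup⇒[]= (g a) (image g A)
    (trans (lookup∘tabulate _ (g a)) (Equivalence.to T-≡ (fromWitness (a , a∈A , refl))))

∈-image⁻ : ∀ {m n} (g : Fin m → Fin n) {A : Subset m} {b : Fin n} → b ∈ image g A → InImage g A b
∈-image⁻ g {A} {b} b∈gA =
  toWitness (Equivalence.from T-≡ (trans (sym (lookup∘tabulate _ b)) ([]=⇒lookup b∈gA)))

∣image∣≤ : ∀ {m n} (g : Fin m → Fin n) (A : Subset m) → ∣ image g A ∣ ≤ ∣ A ∣
∣image∣≤ g A = ∣B∣≤∣A∣-of-cover g A (image g A) (∈-image⁻ g)

firstSuccess : ∀ {a b m} {R : Set a} {F : Fin m → Set b} → (∀ i → R ⊎ F i) → R ⊎ (∀ i → F i)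
firstSuccess {m = zero} try = inj₂ λ ()
firstSuccess {m = suc m} {F = F} try with try zero | firstSuccess {F = F ∘ suc} (try ∘ suc)
... | inj₁ r   | _        = inj₁ r
... | inj₂ _   | inj₁ r   = inj₁ r
... | inj₂ F₀  | inj₂ Fₛ  = inj₂ λ { zero → F₀ ; (suc i) → Fₛ i }

-- Hall's alternative for a Bool-valued relation A on Fin n (read: "v may be
-- matched to w"), by augmenting-path search.  Vertex sets handled by the
-- search are decidable predicates, because it forms unions of them.
module HallAlternative {n : ℕ} (A : Fin n → Fin n → Bool) where

  VSet : Set₁
  VSet = Pred (Fin n) 0ℓ

  record Matches (B D : VSet) (f : Fin n → Fin n) : Set where
    constructor matches
    field
      adjacent  : ∀ {v} → D v → A v (f v) ≡ true
      allowed   : ∀ {v} → D v → ¬ B (f v)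
      injective : ∀ {u v} → D u → D v → f u ≡ f v → u ≡ v
  open Matches

  Matchable : VSet → VSet → Set
  Matchable B D = ∃ (Matches B D)

  Matches-mono : ∀ {B B′ D D′ f} → B ⊆ B′ → D ⊆ D′ → Matches B′ D′ f → Matches B D f
  Matches-mono B⊆B′ D⊆D′ m =
    matches (adjacent m ∘ D⊆D′) (λ v∈D → allowed m (D⊆D′ v∈D) ∘ B⊆B′)
            (λ u∈D v∈D → injective m (D⊆D′ u∈D) (D⊆D′ v∈D))

  _◃_ : Fin n → Subset n → VSet
  (x ◃ P) v = v ≡ x ⊎ v ∈ P

  ◃-remove⁺ : ∀ {P x} → (_∈ P) ⊆ (x ◃ (P - x))
  ◃-remove⁺ {x = x} {v} v∈P with v ≟ x
  ... | yes v≡x = inj₁ v≡x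
  ... | no  v≢x = inj₂ (x∈p∧x≢y⇒x∈p-y v∈P v≢x)

  ◃-remove⁻ : ∀ {P x} → x ∈ P → (x ◃ (P - x)) ⊆ (_∈ P)
  ◃-remove⁻ x∈P (inj₁ refl)  = x∈P
  ◃-remove⁻ {P} {x} _ (inj₂ v∈P-x) = p─q⊆p P ⁅ x ⁆ v∈P-x

  -- S is closed under alternating paths w.r.t. f: every A-neighbour of S is
  -- forbidden or is the partner of a vertex of S ∩ P.
  Closed : VSet → Subset n → (Fin n → Fin n) → VSet → Set
  Closed B P f S = ∀ {s z} → S s → A s z ≡ true → B z ⊎ ∃ λ s′ → S s′ × s′ ∈ P × f s′ ≡ z

  -- Certificate that the matching f of P cannot be extended to x0 (avoiding B).
  record Stuck (B : VSet) (P : Subset n) (f : Fin n → Fin n) (x0 : Fin n) : Set₁ where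
    field
      S        : VSet
      S?       : Decidable S
      root     : S x0
      S⊆       : S ⊆ (x0 ◃ P)
      S-closed : Closed B P f S

  -- Certificate that no augmenting path starts with the edge x0 y: a closed
  -- set T ⊆ P containing the partner of y whenever y is an allowed neighbour.
  record Blocked (B : VSet) (P : Subset n) (f : Fin n → Fin n) (x0 y : Fin n) : Set₁ where
    field
      T         : VSet
      T?        : Decidable T
      T⊆P       : T ⊆ (_∈ P)
      T-closed  : Closed B P f T
      partner∈T : A x0 y ≡ true → ¬ B y → ∃ λ x1 → T x1 × x1 ∈ P × f x1 ≡ y

  trivially : ∀ {B P f x0 y} → (A x0 y ≡ true → ¬ B y → ⊥) → Blocked B P f x0 y
  trivially impossible = record
    { T = ∅ ; T? = ∅? ; T⊆P = λ () ; T-closed = λ ()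
    ; partner∈T = λ x0~y ¬By → ⊥-elim (impossible x0~y ¬By) }

  -- The induction hypothesis of the search: for sets P of fewer than k vertices,
  -- a matching of P extends to any new vertex x0 unless x0 is stuck.
  Augments : ℕ → Set₁
  Augments k = ∀ {B} → Decidable B → ∀ {P} → ∣ P ∣ < k → ∀ {f} → Matches B (_∈ P) f →
               ∀ {x0} → x0 ∉ P → Matchable B (x0 ◃ P) ⊎ Stuck B P f x0

  extend : ∀ {B P f x0 y} → Matches B (_∈ P) f → x0 ∉ P → A x0 y ≡ true → ¬ B y →
           (∀ {v} → v ∈ P → f v ≢ y) → Matchable B (x0 ◃ P)
  extend {B} {P} {f} {x0} {y} m x0∉P x0~y ¬By y-free = g , matches adjacent′ allowed′ injective′
    where
    g : Fin n → Fin n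
    g = updateAt f x0 (λ _ → y)
    g-x0 : g x0 ≡ y
    g-x0 = updateAt-updates x0 f
    g-P : ∀ {v} → v ∈ P → g v ≡ f v
    g-P {v} v∈P = updateAt-minimal v x0 f (λ { refl → x0∉P v∈P })
    adjacent′ : ∀ {v} → (x0 ◃ P) v → A v (g v) ≡ true
    adjacent′ (inj₁ refl) rewrite g-x0   = x0~y
    adjacent′ (inj₂ v∈P)  rewrite g-P v∈P = adjacent m v∈P
    allowed′ : ∀ {v} → (x0 ◃ P) v → ¬ B (g v)
    allowed′ (inj₁ refl) rewrite g-x0   = ¬By
    allowed′ (inj₂ v∈P)  rewrite g-P v∈P = allowed m v∈P
    injective′ : ∀ {u v} → (x0 ◃ P) u → (x0 ◃ P) v → g u ≡ g v → u ≡ v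
    injective′ (inj₁ refl) (inj₁ refl) _ = refl
    injective′ (inj₁ refl) (inj₂ v∈P) e = ⊥-elim (y-free v∈P (trans (sym (g-P v∈P)) (trans (sym e) g-x0)))
    injective′ (inj₂ u∈P) (inj₁ refl) e = ⊥-elim (y-free u∈P (trans (sym (g-P u∈P)) (trans e g-x0)))
    injective′ (inj₂ u∈P) (inj₂ v∈P) e = injective m u∈P v∈P (trans (sym (g-P u∈P)) (trans e (g-P v∈P)))

  -- Unmatching x1 turns its partner into a forbidden vertex for the rest of P.
  forbidPartner : ∀ {B P f x1} → Matches B (_∈ P) f → x1 ∈ P → Matches (B ∪ ｛ f x1 ｝) (_∈ P - x1) f
  forbidPartner {B} {P} {f} {x1} m x1∈P =
    matches (adjacent m ∘ shrink) allowed′ (λ u∈ v∈ → injective m (shrink u∈) (shrink v∈))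
    where
    shrink : (_∈ P - x1) ⊆ (_∈ P)
    shrink = p─q⊆p P ⁅ x1 ⁆
    allowed′ : ∀ {v} → v ∈ P - x1 → ¬ (B ∪ ｛ f x1 ｝) (f v)
    allowed′ v∈ (inj₁ B-fv)    = allowed m (shrink v∈) B-fv
    allowed′ v∈ (inj₂ fx1≡fv) = x∈p-y⇒x≢y P v∈ (sym (injective m x1∈P (shrink v∈) fx1≡fv))

  blockedBy : ∀ {B P f x0 x1} → x1 ∈ P → Stuck (B ∪ ｛ f x1 ｝) (P - x1) f x1 → Blocked B P f x0 (f x1)
  blockedBy {B} {P} {f} {x1 = x1} x1∈P stuck = record
    { T = S ; T? = S? ; T⊆P = ◃-remove⁻ x1∈P ∘ S⊆ ; T-closed = closed
    ; partner∈T = λ _ _ → x1 , root , x1∈P , refl }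
    where
    open Stuck stuck
    closed : Closed B P f S
    closed Ss s~z with S-closed Ss s~z
    ... | inj₁ (inj₁ Bz)   = inj₁ Bz
    ... | inj₁ (inj₂ refl) = inj₂ (x1 , root , x1∈P , refl)
    ... | inj₂ (s′ , Ss′ , s′∈P-x1 , e) = inj₂ (s′ , Ss′ , p─q⊆p P ⁅ x1 ⁆ s′∈P-x1 , e)

  -- The edge x0 y where y = f x1: search recursively for a new partner of x1 in P - x1.
  rematch : ∀ {k} → Augments k → ∀ {B} → Decidable B → ∀ {P} → ∣ P ∣ < suc k → ∀ {f} →
    Matches B (_∈ P) f → ∀ {x0 x1} → x0 ∉ P → x1 ∈ P → A x0 (f x1) ≡ true → ¬ B (f x1) →
    Matchable B (x0 ◃ P) ⊎ Blocked B P f x0 (f x1)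
  rematch augment {B} B? {P} ∣P∣≤k {f} m {x1 = x1} x0∉P x1∈P x0~y ¬By
    with augment (B? ∪? (f x1 ≟_)) (<-≤-trans (x∈p⇒∣p-x∣<∣p∣ x1∈P) (≤-pred ∣P∣≤k))
                 (forbidPartner m x1∈P) (λ x1∈P-x1 → x∈p-y⇒x≢y P x1∈P-x1 refl)
  ... | inj₁ (g , m′) = inj₁ (extend (Matches-mono inj₁ ◃-remove⁺ m′) x0∉P x0~y ¬By
                                     (λ v∈P gv≡y → allowed m′ (◃-remove⁺ v∈P) (inj₂ (sym gv≡y))))
  ... | inj₂ stuck = inj₂ (blockedBy x1∈P stuck)

  tryNeighbour : ∀ {k} → Augments k → ∀ {B} → Decidable B → ∀ {P} → ∣ P ∣ < suc k → ∀ {f} →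
    Matches B (_∈ P) f → ∀ {x0} → x0 ∉ P → (y : Fin n) → Matchable B (x0 ◃ P) ⊎ Blocked B P f x0 y
  tryNeighbour augment B? {P} ∣P∣≤k {f} m {x0} x0∉P y with A x0 y ≟ᵇ true | B? y
  ... | no x0≁y  | _      = inj₂ (trivially λ x0~y _ → x0≁y x0~y)
  ... | yes _    | yes By = inj₂ (trivially λ _ ¬By → ¬By By)
  ... | yes x0~y | no ¬By with any? (λ x1 → (x1 ∈? P) ×-dec (f x1 ≟ y))
  ...   | no y-free = inj₁ (extend m x0∉P x0~y ¬By (λ v∈P fv≡y → y-free (_ , v∈P , fv≡y)))
  ...   | yes (x1 , x1∈P , refl) = rematch augment B? ∣P∣≤k m x0∉P x1∈P x0~y ¬By

  -- If every edge at x0 is blocked, then x0 together with all the blocking sets is stuck.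
  stuckFrom : ∀ {B P f x0} → Decidable B → (∀ y → Blocked B P f x0 y) → Stuck B P f x0
  stuckFrom {B} {P} {f} {x0} B? blocked = record
    { S = U ; S? = U? ; root = inj₁ refl ; S⊆ = U⊆ ; S-closed = U-closed }
    where
    module Bl (y : Fin n) = Blocked (blocked y)
    U : VSet
    U s = s ≡ x0 ⊎ ∃ λ y → Bl.T y s
    U? : Decidable U
    U? s = (s ≟ x0) ⊎-dec any? (λ y → Bl.T? y s)
    U⊆ : U ⊆ (x0 ◃ P)
    U⊆ (inj₁ s≡x0)   = inj₁ s≡x0
    U⊆ (inj₂ (y , t)) = inj₂ (Bl.T⊆P y t)
    U-closed : Closed B P f U
    U-closed {z = z} (inj₁ refl) x0~z with B? z
    ... | yes Bz = inj₁ Bz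
    ... | no ¬Bz with Bl.partner∈T z x0~z ¬Bz
    ...   | x1 , t , x1∈P , e = inj₂ (x1 , inj₂ (z , t) , x1∈P , e)
    U-closed (inj₂ (y , t)) s~z with Bl.T-closed y t s~z
    ... | inj₁ Bz = inj₁ Bz
    ... | inj₂ (s′ , t′ , s′∈P , e) = inj₂ (s′ , inj₂ (y , t′) , s′∈P , e)

  augments : ∀ k → Augments k
  augments zero    B? ()
  augments (suc k) B? ∣P∣≤k m x0∉P with firstSuccess (tryNeighbour (augments k) B? ∣P∣≤k m x0∉P)
  ... | inj₁ matchable = inj₁ matchable
  ... | inj₂ blocked   = inj₂ (stuckFrom B? blocked)

  -- A Hall violator inside P: a set S ⊆ P with a root x0 such that every
  -- neighbour of S is the partner of a vertex of S other than x0, so that S has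
  -- fewer neighbours than elements.
  record Deficient (P : Subset n) : Set₁ where
    field
      S       : VSet
      S?      : Decidable S
      x0      : Fin n
      root    : S x0
      S⊆P     : S ⊆ (_∈ P)
      partner : Fin n → Fin n
      covered : ∀ {s z} → S s → A s z ≡ true → ∃ λ s′ → S s′ × s′ ≢ x0 × partner s′ ≡ z

  Deficient-mono : ∀ {P Q} → (_∈ P) ⊆ (_∈ Q) → Deficient P → Deficient Q
  Deficient-mono P⊆Q d = record
    { S = S ; S? = S? ; x0 = x0 ; root = root ; S⊆P = P⊆Q ∘ S⊆P ; partner = partner ; covered = covered }
    where open Deficient d

  deficientFrom : ∀ {P f x} → x ∈ P → Stuck ∅ (P - x) f x → Deficient P
  deficientFrom {P} {f} {x} x∈P stuck = record
    { S = S ; S? = S? ; x0 = x ; root = root ; S⊆P = ◃-remove⁻ x∈P ∘ S⊆ ; partner = f ; covered = covered }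
    where
    open Stuck stuck
    covered : ∀ {s z} → S s → A s z ≡ true → ∃ λ s′ → S s′ × s′ ≢ x × f s′ ≡ z
    covered Ss s~z with S-closed Ss s~z
    ... | inj₂ (s′ , Ss′ , s′∈P-x , e) = s′ , Ss′ , x∈p-y⇒x≢y P s′∈P-x , e

  -- Hall's theorem in alternative form: P can be matched injectively into its
  -- neighbourhood, or P contains a Hall violator.  (Add the vertices of P one
  -- at a time, extending the matching by the search above.)
  hallAlternative : (P : Subset n) → Matchable ∅ (_∈ P) ⊎ Deficient P
  hallAlternative P = bounded ∣ P ∣ P ≤-refl
    where
    bounded : ∀ k P → ∣ P ∣ ≤ k → Matchable ∅ (_∈ P) ⊎ Deficient P
    bounded zero P ∣P∣≤0 = inj₁ ((λ v → v) , matches (⊥-elim ∘ empty) (⊥-elim ∘ empty) (⊥-elim ∘ empty))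
      where
      empty : ∀ {v} → v ∉ P
      empty v∈P with ≤-trans (x∈p⇒∣p-x∣<∣p∣ v∈P) ∣P∣≤0
      ... | ()
    bounded (suc k) P ∣P∣≤1+k with nonempty? P
    ... | no P-empty = bounded zero P (≤-reflexive (∣Empty∣≡0 P-empty))
    ... | yes (x , x∈P) with bounded k (P - x) (≤-pred (≤-trans (x∈p⇒∣p-x∣<∣p∣ x∈P) ∣P∣≤1+k))
    ...   | inj₂ d = inj₂ (Deficient-mono (p─q⊆p P ⁅ x ⁆) d)
    ...   | inj₁ (f , m) with augments (suc ∣ P - x ∣) ∅? ≤-refl m (λ x∈P-x → x∈p-y⇒x≢y P x∈P-x refl)
    ...     | inj₁ (g , m′) = inj₁ (g , Matches-mono (λ ()) ◃-remove⁺ m′)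
    ...     | inj₂ stuck    = inj₂ (deficientFrom x∈P stuck)

open HallAlternative using (Matches; matches; Deficient; hallAlternative)

neighbour-of-X : ∀ {n} {G : Graph n} {X : Subset n} → IsBipartition G X →
                 ∀ {u v} → u ∈ X → adj G u v ≡ true → v ∉ X
neighbour-of-X bip {u} {v} u∈X u~v with bip u v u~v
... | inj₁ (_ , v∉X) = v∉X
... | inj₂ (u∉X , _) = ⊥-elim (u∉X u∈X)

neighbour-of-Y : ∀ {n} {G : Graph n} {X : Subset n} → IsBipartition G X →
                 ∀ {u v} → u ∉ X → adj G u v ≡ true → v ∈ X
neighbour-of-Y bip {u} {v} u∉X u~v with bip u v u~v
... | inj₁ (u∈X , _) = ⊥-elim (u∉X u∈X)
... | inj₂ (_ , v∈X) = v∈X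

firstStep : ∀ {n} {G : Graph n} {v w : Fin n} → v ≢ w → Walk G v w → ∃ λ u → adj G v u ≡ true
firstStep v≢w here           = ⊥-elim (v≢w refl)
firstStep _   (step v~u _) = _ , v~u

outsideVertex : ∀ {n} {X : Subset n} {x} → x ∈ X → ∣ X ∣ ≤ ∣ ∁ X ∣ → ∃ λ y → y ∉ X
outsideVertex {X = X} x∈X ∣X∣≤∣∁X∣ with nonempty? (∁ X)
... | yes (y , y∈∁X) = y , x∈∁p⇒x∉p y∈∁X
... | no ∁X-empty with ≤-trans (x∈p⇒∣p-x∣<∣p∣ x∈X) (≤-trans ∣X∣≤∣∁X∣ (≤-reflexive (∣Empty∣≡0 ∁X-empty)))
...   | ()

-- In a connected graph where X is nonempty and no larger than its complement,
-- no vertex is isolated: every vertex differs from x ∈ X or from some y ∉ X,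
-- and a walk to it starts with an edge.
noIsolatedVertex : ∀ {n} (G : Graph n) {X : Subset n} {x} →
                   Connected G → x ∈ X → ∣ X ∣ ≤ ∣ ∁ X ∣ → ∀ v → ∃ λ u → adj G v u ≡ true
noIsolatedVertex G {x = x} conn x∈X ∣X∣≤∣∁X∣ v with outsideVertex x∈X ∣X∣≤∣∁X∣ | v ≟ x
... | y , y∉X | yes refl = firstStep (λ { refl → y∉X x∈X }) (conn v y)
... | _       | no  v≢x  = firstStep v≢x (conn v x)

elements : ∀ {n} → Subset n → List (Fin n)
elements []            = []
elements (inside ∷ p)  = zero ∷ map suc (elements p)
elements (outside ∷ p) = map suc (elements p)

length-elements : ∀ {n} (p : Subset n) → length (elements p) ≡ ∣ p ∣
length-elements []            = refl
length-elements (inside ∷ p)  = cong suc (trans (length-map suc (elements p)) (length-elements p))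
length-elements (outside ∷ p) = trans (length-map suc (elements p)) (length-elements p)

elements-unique : ∀ {n} (p : Subset n) → Unique (elements p)
elements-unique []            = []
elements-unique (inside ∷ p)  =
  AllP.map⁺ (All.universal (λ _ ()) (elements p)) ∷ Unique.map⁺ suc-injective (elements-unique p)
elements-unique (outside ∷ p) = Unique.map⁺ suc-injective (elements-unique p)

elements-⊆ : ∀ {n} (p : Subset n) → All (_∈ p) (elements p)
elements-⊆ []            = []
elements-⊆ (inside ∷ p)  = here ∷ AllP.map⁺ (All.map there (elements-⊆ p))
elements-⊆ (outside ∷ p) = AllP.map⁺ (All.map there (elements-⊆ p))

All-endpoints⁺ : ∀ {n ℓ} {P : Pred (Fin n) ℓ} (f : Fin n → Fin n) (L : List (Fin n)) →
                 All P L → All (P ∘ f) L → All P (endpoints (map (λ x → x , f x) L))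
All-endpoints⁺ f []      []           []             = []
All-endpoints⁺ f (x ∷ L) (Px ∷ PL) (Pfx ∷ PfL) = Px ∷ Pfx ∷ All-endpoints⁺ f L PL PfL

-- An injection f of X into the neighbourhood gives the matching { x f(x) : x ∈ X };
-- its endpoints are distinct because x ∈ X, f(x) ∉ X and f is injective on X.
matchingOf : ∀ {n} (G : Graph n) (X : Subset n) → IsBipartition G X → ∀ {f} →
  Matches (adj G) ∅ (_∈ X) f → Σ (List (Fin n × Fin n)) λ M → IsMatching G M × length M ≡ ∣ X ∣
matchingOf {n} G X bip {f} m =
  map edge (elements X) ,
  (AllP.map⁺ (All.map (Matches.adjacent m) (elements-⊆ X)) ,
   distinct (elements X) (elements-unique X) (elements-⊆ X)) ,
  trans (length-map edge (elements X)) (length-elements X)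
  where
  edge : Fin n → Fin n × Fin n
  edge x = x , f x
  fx∉X : ∀ {x} → x ∈ X → f x ∉ X
  fx∉X x∈X = neighbour-of-X {G = G} bip x∈X (Matches.adjacent m x∈X)
  apart : ∀ {u v} → u ∈ X → v ∉ X → u ≢ v
  apart u∈X v∉X refl = v∉X u∈X
  distinct : ∀ L → Unique L → All (_∈ X) L → Unique (endpoints (map edge L))
  distinct []      _            _            = []
  distinct (x ∷ L) (x∉L ∷ uL) (x∈X ∷ L⊆X) =
      (apart x∈X (fx∉X x∈X) ∷ All-endpoints⁺ f L x∉L (All.map (λ y∈X → apart x∈X (fx∉X y∈X)) L⊆X))
    ∷ (All-endpoints⁺ f L (All.map (λ y∈X → apart y∈X (fx∉X x∈X) ∘ sym) L⊆X)
                          (All.zipWith (λ { (x≢y , y∈X) → x≢y ∘ Matches.injective m x∈X y∈X }) (x∉L , L⊆X)))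
    ∷ distinct L uL L⊆X

-- A Hall violator S ⊆ X with root x0 yields a dominating set smaller than X,
-- namely g[X - x0] where g replaces each vertex of S by its partner: the
-- partners of S - x0 contain every neighbour of S, so they dominate S and its
-- neighbours, while X - S dominates the remaining vertices (all outside X).
smallDominatingSet : ∀ {n} (G : Graph n) (X : Subset n) → IsBipartition G X →
  (∀ v → ∃ λ u → adj G v u ≡ true) → Deficient (adj G) X →
  ∃ λ D → Dominating G D × ∣ D ∣ < ∣ X ∣
smallDominatingSet {n} G X bip neighbour d =
  D , dominating , <-≤-trans (s≤s (∣image∣≤ g (X - x0))) (x∈p⇒∣p-x∣<∣p∣ (S⊆P root))
  where
  open Deficient d
  g : Fin n → Fin n
  g v with S? v
  ... | yes _ = partner v
  ... | no  _ = v
  D : Subset n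
  D = image g (X - x0)
  g-image : ∀ {v} → v ∈ X → v ≢ x0 → g v ∈ D
  g-image v∈X v≢x0 = ∈-image⁺ g (x∈p∧x≢y⇒x∈p-y v∈X v≢x0)
  partner∈D : ∀ {s} → S s → s ≢ x0 → partner s ∈ D
  partner∈D {s} Ss s≢x0 with S? s | g-image (S⊆P Ss) s≢x0
  ... | yes _  | gs∈D = gs∈D
  ... | no ¬Ss | _    = ⊥-elim (¬Ss Ss)
  unreplaced∈D : ∀ {v} → v ∈ X → ¬ S v → v ∈ D
  unreplaced∈D {v} v∈X ¬Sv with S? v | g-image v∈X (λ { refl → ¬Sv root })
  ... | yes Sv | _    = ⊥-elim (¬Sv Sv)
  ... | no _   | gv∈D = gv∈D
  neighbourOfS∈D : ∀ {s z} → S s → adj G s z ≡ true → z ∈ D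
  neighbourOfS∈D Ss s~z with covered Ss s~z
  ... | s′ , Ss′ , s′≢x0 , e = subst (_∈ D) e (partner∈D Ss′ s′≢x0)
  dominating : Dominating G D
  dominating v with S? v | neighbour v
  ... | yes Sv | z , v~z = inj₂ (z , neighbourOfS∈D Sv v~z , trans (symm G z v) v~z)
  ... | no ¬Sv | u , v~u with v ∈? X | S? u
  ...   | yes v∈X | _      = inj₁ (unreplaced∈D v∈X ¬Sv)
  ...   | no _    | yes Su = inj₁ (neighbourOfS∈D Su (trans (symm G u v) v~u))
  ...   | no v∉X  | no ¬Su =
    inj₂ (u , unreplaced∈D (neighbour-of-Y {G = G} bip v∉X v~u) ¬Su , trans (symm G u v) v~u)

proposition3 : ∀ {n} (G : Graph n) (X : Subset n) →
    Connected G → IsBipartition G X → ∣ X ∣ ≤ ∣ ∁ X ∣ →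
    DominationNumber G ∣ X ∣ →
    Σ (List (Fin n × Fin n)) λ M → IsMatching G M × length M ≡ ∣ X ∣
proposition3 G X conn bip ∣X∣≤∣Y∣ (_ , minimal) with hallAlternative (adj G) X
... | inj₁ (f , m) = matchingOf G X bip m
... | inj₂ d
  with smallDominatingSet G X bip (noIsolatedVertex G conn (Deficient.S⊆P d (Deficient.root d)) ∣X∣≤∣Y∣) d
...   | D , D-dominating , ∣D∣<∣X∣ = ⊥-elim (<⇒≱ ∣D∣<∣X∣ (minimal D D-dominating))
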